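{- Let $k\ge3$ and $L\ge1$ be integers. There is a constant $\alpha=\alpha(k,L)>1$ such that for every sufficiently large integer $N$ the following holds. In the $(1:k-2)$ Maker–Breaker game played on the edge set of an $(N,L)$-tree $T^*$ (even if Breaker moves first), Maker has a strategy to claim the edges of a subtree $T\subset T^*$ containing at least $\alpha^N$ vertices that are $k$-heavy in $T^*$; moreover, under this strategy Maker's graph is a tree at all times until $T$ is achieved.
   Context: In the $(1:b)$ Maker–Breaker game on a finite edge set, the players alternately claim previously unclaimed edges, Maker one per move and Breaker $b$ per move. In a rooted tree, the level of a vertex is its distance from the root and the height is the maximum level. A non-leaf vertex is $k$-light if it has fewer than $k$ children and $k$-heavy otherwise (leaves are neither). A tree path is a sequence $(v_0,\dots,v_j)$ of vertices with $v_{i-1}$ the parent of $v_i$; it is $k$-light if all its vertices are $k$-light; its length is its number of vertices. A balanced tree is a rooted tree all of whose leaves are at the same level. An $(N,L)$-tree is a balanced tree of height $N$ with no $(k-1)$-light vertices and no $k$-light tree paths of length $L$. -}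

module Defs where

open import Data.Nat using (ℕ; zero; suc; _+_; _*_; _^_; _≤_; _<_; _∸_)
open import Data.List using (List; []; _∷_; _++_; length)
open import Data.List.Relation.Unary.Any using (Any)
open import Data.List.Relation.Unary.All using (All)
open import Data.List.Membership.Propositional using (_∈_; _∉_)
open import Data.List.Relation.Unary.Unique.Propositional using (Unique)
open import Data.Maybe using (Maybe; just; nothing)
open import Data.Product using (Σ; ∃; _×_; _,_)
open import Data.Sum using (_⊎_)
open import Data.Unit using (⊤)
open import Relation.Nullary using (¬_)
open import Relation.Binary.PropositionalEquality using (_≡_)
open import Relation.Binary.Construct.Closure.ReflexiveTransitive using (Star)

data RTree : Set where
  node : List RTree → RTree

children : RTree → List RTree
children (node ts) = ts

-- A vertex of a tree is addressed by the list of child indices on the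
-- path from the root; its level is the length of the address.
Addr : Set
Addr = List ℕ

mutual
  at : RTree → Addr → Maybe RTree
  at t [] = just t
  at (node ts) (i ∷ a) = atList ts i a

  atList : List RTree → ℕ → Addr → Maybe RTree
  atList [] _ _ = nothing
  atList (s ∷ ss) zero a = at s a
  atList (s ∷ ss) (suc i) a = atList ss i a

IsVertex : RTree → Addr → Set
IsVertex t a = ∃ λ s → at t a ≡ just s

Light : ℕ → RTree → Set
Light k s = 0 < length (children s) × length (children s) < k

Heavy : ℕ → RTree → Set
Heavy k s = k ≤ length (children s)

HeavyIn : RTree → ℕ → Addr → Set
HeavyIn t k a = ∃ λ s → at t a ≡ just s × Heavy k s

-- LightPath k m s : there is a k-light tree path of length m (m vertices)
-- starting at the root of s.
LightPath : ℕ → ℕ → RTree → Set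
LightPath k zero s = ⊤
LightPath k (suc m) s = Light k s × (m ≡ 0 ⊎ Any (LightPath k m) (children s))

BalancedOfHeight : ℕ → RTree → Set
BalancedOfHeight N t = ∀ a s → at t a ≡ just s → children s ≡ [] → length a ≡ N

NLTree : ℕ → ℕ → ℕ → RTree → Set
NLTree k N L t =
  BalancedOfHeight N t
  × (∀ a s → at t a ≡ just s → ¬ Light (k ∸ 1) s)
  × (∀ a s → at t a ≡ just s → ¬ LightPath k L s)

-- Edges: the edge between vertex p and its child with index i.

Edge : Set
Edge = Addr × ℕ

IsEdge : RTree → Edge → Set
IsEdge t (p , i) = IsVertex t (p ++ i ∷ [])

data Endpoint : Edge → Addr → Set where
  upper : ∀ {p i} → Endpoint (p , i) p
  lower : ∀ {p i} → Endpoint (p , i) (p ++ i ∷ [])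

InGraph : List Edge → Addr → Set
InGraph M v = Any (λ e → Endpoint e v) M

Touch : List Edge → Edge → Edge → Set
Touch M e f = e ∈ M × f ∈ M × ∃ λ v → Endpoint e v × Endpoint f v

Connected : List Edge → Set
Connected M = ∀ e f → e ∈ M → f ∈ M → Star (Touch M) e f

Free : RTree → List Edge → List Edge → Edge → Set
Free t M B e = IsEdge t e × e ∉ M × e ∉ B

BreakerMove : RTree → ℕ → List Edge → List Edge → List Edge → Set
BreakerMove t b M B S =
  Unique S × All (Free t M B) S
  × (length S ≡ b ⊎ (length S < b × (∀ e → Free t M B e → e ∈ S)))

-- Maker's goal: Maker's graph contains at least (p/q)^N vertices that are
-- k-heavy in t, i.e. q^N * #(such vertices) ≥ p^N.
Goal : RTree → ℕ → ℕ → ℕ → ℕ → List Edge → Set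
Goal t k p q N M =
  Σ (List Addr) λ vs → Unique vs
    × All (λ v → InGraph M v × HeavyIn t k v) vs
    × p ^ N ≤ length vs * q ^ N

-- Maker has a strategy (from the given position) to reach the goal while
-- keeping his graph connected (hence a tree, being a subgraph of t)
-- after each of his moves until the goal is reached.
module Game (t : RTree) (b : ℕ) (Won : List Edge → Set) where
  mutual
    data MakerToMove (M B : List Edge) : Set where
      done : Won M → MakerToMove M B
      move : (e : Edge) → Free t M B e → Connected (e ∷ M)
           → BreakerToMove (e ∷ M) B → MakerToMove M B

    data BreakerToMove (M B : List Edge) : Set where
      done : Won M → BreakerToMove M B
      reply : (∀ S → BreakerMove t b M B S → MakerToMove M (S ++ B))
            → BreakerToMove M B

MakerWinsFirst : RTree → ℕ → (List Edge → Set) → Set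
MakerWinsFirst t b Won = Game.MakerToMove t b Won [] []

MakerWinsSecond : RTree → ℕ → (List Edge → Set) → Set
MakerWinsSecond t b Won = Game.BreakerToMove t b Won [] []

-- Maker keeps tokens: unclaimed edges hanging off his tree below which nothing is claimed yet, in
-- pairwise disjoint subtrees, each carrying a value bounded by the potential Φ of its subtree. Φ is 0
-- at leaves, the least potential m of a child at a vertex with k-1 children, and (k m + C)/(k-1) at a
-- k-heavy vertex; so a token of value x can be traded for tokens min(x, Φ c), one per child c, of total
-- value at least (k-1) x - C, the C being paid only at heavy vertices. Maker claims the edge of a most
-- valuable token and trades it; each of Breaker's k-2 edges lies below at most one token, worth at most
-- x. Hence the total value of the tokens plus C for every heavy vertex Maker reached never drops below
-- Φ(root) - C, and when no tokens are left Maker has reached Φ(root)/C - 1 heavy vertices. Along any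
-- downward path of an (N,L)-tree a heavy vertex occurs among every L consecutive vertices, which gives
-- Φ(root) ≥ k^J - C for J = ⌊N/L⌋ and C = (k-1)^J, that is (k/(k-1))^J - 2 heavy vertices; this exceeds
-- (p/q)^N for large N as soon as (p/q)^L < k/(k-1).

module Submission where

open import Defs
open import Data.Nat
  using (ℕ; zero; suc; _+_; _*_; _^_; _∸_; _⊓_; _/_; _≤_; _<_; NonZero; z≤n; s≤s; s≤s⁻¹)
open import Data.Nat.Properties
open import Data.Nat.DivMod using (_%_; m/n*n≤m; m*n/n≡m; /-monoˡ-≤; m≡m%n+[m/n]*n; m%n<n)
open import Data.Nat.GeneralisedArithmetic using (fold)
open import Data.Nat.ListAction using (sum)
open import Data.Nat.ListAction.Properties using (sum-++)
open import Data.Nat.Tactic.RingSolver using (solve-∀)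
open import Data.Product using (Σ; _×_; _,_; proj₁; proj₂; swap; map₁; map₂)
open import Data.Sum as Sum using (_⊎_; inj₁; inj₂)
open import Data.Empty using (⊥-elim)
open import Data.Maybe using (just)
open import Data.List using (List; []; _∷_; _++_; _∷ʳ_; length; map)
open import Data.List.Properties using (map-++)
open import Data.List.Extrema ≤-totalOrder using (argmax; argmax-sel; f[⊥]≤f[argmax]; f[xs]≤f[argmax])
open import Data.List.Membership.Propositional using (_∈_; find)
open import Data.List.Membership.Propositional.Properties using (∈-++⁻)
open import Data.List.Relation.Unary.Any as Any using (Any; here; there; _─_)
open import Data.List.Relation.Unary.All as All using (All; []; _∷_)
open import Data.List.Relation.Unary.All.Properties as Allₚ using (All¬⇒¬Any; ─⁺)
open import Data.List.Relation.Unary.AllPairs using (AllPairs; []; _∷_)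
import Data.List.Relation.Unary.AllPairs.Properties as AllPairsₚ
open import Data.List.Relation.Unary.Unique.Propositional using (Unique)
open import Data.List.Relation.Binary.Prefix.Heterogeneous using (Prefix; []; _∷_; _++ᵖ_)
open import Data.List.Relation.Binary.Prefix.Heterogeneous.Properties as Prefix using (fromPointwise; prefix?)
import Data.List.Relation.Binary.Pointwise as Pointwise
open import Function using (id)
open import Relation.Nullary using (¬_; Dec; yes; no)
open import Relation.Binary.Construct.Closure.ReflexiveTransitive using (Star; ε; _◅_; _◅◅_; gmap)
open import Relation.Binary.PropositionalEquality
  using (_≡_; _≢_; refl; sym; trans; cong; cong₂; subst)

open ≤-Reasoning

-- Arithmetic

^-distribʳ-* : ∀ m n o → (m * n) ^ o ≡ m ^ o * n ^ o
^-distribʳ-* m n zero = refl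
^-distribʳ-* m n (suc o) = begin-equality
  m * n * (m * n) ^ o       ≡⟨ cong (m * n *_) (^-distribʳ-* m n o) ⟩
  m * n * (m ^ o * n ^ o)   ≡⟨ swap-middle m n (m ^ o) (n ^ o) ⟩
  m * m ^ o * (n * n ^ o)   ∎
  where
  swap-middle : ∀ a b x y → a * b * (x * y) ≡ a * x * (b * y)
  swap-middle = solve-∀

bernoulli : ∀ u J → (u + J) * u ^ J ≤ u * suc u ^ J
bernoulli u zero = ≤-reflexive (cong (_* 1) (+-identityʳ u))
bernoulli u (suc J) = begin
  (u + suc J) * (u * a)              ≤⟨ m≤m+n _ (J * a) ⟩
  (u + suc J) * (u * a) + J * a      ≡⟨ regroup u J a ⟩
  suc u * ((u + J) * a)              ≤⟨ *-monoʳ-≤ (suc u) (bernoulli u J) ⟩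
  suc u * (u * b)                    ≡⟨ *-comm-middle (suc u) u b ⟩
  u * (suc u * b)                    ∎
  where
  a = u ^ J
  b = suc u ^ J
  regroup : ∀ u J a → (u + suc J) * (u * a) + J * a ≡ suc u * ((u + J) * a)
  regroup = solve-∀
  *-comm-middle : ∀ x y z → x * (y * z) ≡ y * (x * z)
  *-comm-middle = solve-∀

pow-outgrows-linear : ∀ {u v} m J → .{{NonZero u}} → u < v → m * u ≤ J → m * u ^ J ≤ v ^ J
pow-outgrows-linear {u} {v} m J u<v mu≤J = *-cancelˡ-≤ u (begin
  u * (m * u ^ J)    ≡⟨ reassoc u m (u ^ J) ⟩
  m * u * u ^ J      ≤⟨ *-monoˡ-≤ (u ^ J) mu≤J ⟩
  J * u ^ J          ≤⟨ *-monoˡ-≤ (u ^ J) (m≤n+m J u) ⟩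
  (u + J) * u ^ J    ≤⟨ bernoulli u J ⟩
  u * suc u ^ J      ≤⟨ *-monoʳ-≤ u (^-monoˡ-≤ J u<v) ⟩
  u * v ^ J          ∎)
  where
  reassoc : ∀ u m x → u * (m * x) ≡ m * u * x
  reassoc = solve-∀

suc-pow-suc≤ : ∀ c L → suc c ^ suc L ≤ c ^ L * suc c + L * suc c ^ L
suc-pow-suc≤ c zero = ≤-reflexive (base c)
  where
  base : ∀ c → suc c * 1 ≡ 1 * suc c + 0
  base = solve-∀
suc-pow-suc≤ c (suc L) = begin
  suc c * (suc c * P)                          ≡⟨ unfold c P ⟩
  c * (suc c * P) + suc c * P                  ≤⟨ +-monoˡ-≤ (suc c * P) (*-monoʳ-≤ c (suc-pow-suc≤ c L)) ⟩
  c * (Q * suc c + L * P) + suc c * P          ≡⟨ distribute c Q L P ⟩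
  c * Q * suc c + L * (c * P) + suc c * P      ≤⟨ +-monoˡ-≤ (suc c * P) (+-monoʳ-≤ (c * Q * suc c)
                                                    (*-monoʳ-≤ L (*-monoˡ-≤ P (n≤1+n c)))) ⟩
  c * Q * suc c + L * (suc c * P) + suc c * P  ≡⟨ collect c Q L P ⟩
  c * Q * suc c + suc L * (suc c * P)          ∎
  where
  P = suc c ^ L
  Q = c ^ L
  unfold : ∀ c P → suc c * (suc c * P) ≡ c * (suc c * P) + suc c * P
  unfold = solve-∀
  distribute : ∀ c Q L P → c * (Q * suc c + L * P) + suc c * P ≡ c * Q * suc c + L * (c * P) + suc c * P
  distribute = solve-∀
  collect : ∀ c Q L P → c * Q * suc c + L * (suc c * P) + suc c * P ≡ c * Q * suc c + suc L * (suc c * P)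
  collect = solve-∀

pow-ratio-gap : ∀ a L .{{_ : NonZero L}} → a * suc (suc a * L) ^ L < suc a * (suc a * L) ^ L
pow-ratio-gap a L = *-cancelˡ-< D _ _ (begin-strict
  D * (a * P)             ≡⟨ swap-front D a P ⟩
  a * (D * P)             ≤⟨ *-monoʳ-≤ a DP≤Q[D+L] ⟩
  a * (Q * (D + L))       <⟨ m<m+n _ (m^n>0 c {{m*n≢0 (suc a) L}} L) ⟩
  a * (Q * (D + L)) + Q   ≡⟨ regroup a L Q ⟩
  D * (suc a * Q)         ∎)
  where
  c = suc a * L
  P = suc c ^ L
  Q = c ^ L
  D = a * L + 1
  suc-c : suc c ≡ D + L
  suc-c = split a L
    where
    split : ∀ a L → suc (suc a * L) ≡ a * L + 1 + L
    split = solve-∀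
  DP≤Q[D+L] : D * P ≤ Q * (D + L)
  DP≤Q[D+L] = +-cancelʳ-≤ (L * P) (D * P) (Q * (D + L)) (begin
    D * P + L * P       ≡⟨ *-distribʳ-+ P D L ⟨
    (D + L) * P         ≤⟨ subst (λ z → z * P ≤ Q * z + L * P) suc-c (suc-pow-suc≤ c L) ⟩
    Q * (D + L) + L * P ∎)
  swap-front : ∀ x y z → x * (y * z) ≡ y * (x * z)
  swap-front = solve-∀
  regroup : ∀ a L Q → a * (Q * ((a * L + 1) + L)) + Q ≡ (a * L + 1) * (suc a * Q)
  regroup = solve-∀

3*≤[2+h]*⇒≤h* : ∀ {P Q} h → Q ≤ P → 3 * P ≤ (2 + h) * Q → P ≤ h * Q
3*≤[2+h]*⇒≤h* {P} {Q} zero Q≤P 3P≤2Q = +-cancelʳ-≤ (2 * P) P 0 (≤-trans 3P≤2Q (*-monoʳ-≤ 2 Q≤P))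
3*≤[2+h]*⇒≤h* {P} {Q} (suc h) _ 3P≤ = *-cancelˡ-≤ 3 (begin
  3 * P                 ≤⟨ 3P≤ ⟩
  (3 + h) * Q           ≤⟨ *-monoˡ-≤ Q (≤-trans (m≤m+n (3 + h) (2 * h)) (≤-reflexive (expand h))) ⟩
  3 * suc h * Q         ≡⟨ *-assoc 3 (suc h) Q ⟩
  3 * (suc h * Q)       ∎)
  where
  expand : ∀ h → 3 + h + 2 * h ≡ 3 * suc h
  expand = solve-∀

≤-*-from-ratio : ∀ {P Q D E} h → .{{NonZero D}} → Q ≤ P → 3 * P * D ≤ E * Q → E ≤ D * (2 + h) → P ≤ h * Q
≤-*-from-ratio {P} {Q} {D} {E} h Q≤P 3PD≤EQ E≤ = 3*≤[2+h]*⇒≤h* h Q≤P (*-cancelˡ-≤ D (begin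
  D * (3 * P)           ≡⟨ *-comm D (3 * P) ⟩
  3 * P * D             ≤⟨ 3PD≤EQ ⟩
  E * Q                 ≤⟨ *-monoˡ-≤ Q E≤ ⟩
  D * (2 + h) * Q       ≡⟨ *-assoc D (2 + h) Q ⟩
  D * ((2 + h) * Q)     ∎))

-- With k = a + 1, the ratio p/q = 1 + 1/(kL) satisfies (p/q)^L < k/(k-1) (pow-ratio-gap).
module GrowthRate (a L : ℕ) .{{_ : NonZero a}} .{{_ : NonZero L}} where

  q p N₀ : ℕ
  q = suc a * L
  p = suc q
  N₀ = 3 * p ^ L * (a * p ^ L) * L

  p^N≤ : ∀ N → p ^ N ≤ (p ^ L) ^ (N / L) * p ^ L
  p^N≤ N = begin
    p ^ N                         ≤⟨ ^-monoʳ-≤ p N≤ ⟩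
    p ^ (N / L * L + L)           ≡⟨ ^-distribˡ-+-* p (N / L * L) L ⟩
    p ^ (N / L * L) * p ^ L       ≡⟨ cong (λ e → p ^ e * p ^ L) (*-comm (N / L) L) ⟩
    p ^ (L * (N / L)) * p ^ L     ≡⟨ cong (_* p ^ L) (^-*-assoc p L (N / L)) ⟨
    (p ^ L) ^ (N / L) * p ^ L     ∎
    where
    N≤ : N ≤ N / L * L + L
    N≤ = begin
      N                   ≡⟨ m≡m%n+[m/n]*n N L ⟩
      N % L + N / L * L   ≤⟨ +-monoˡ-≤ (N / L * L) (<⇒≤ (m%n<n N L)) ⟩
      L + N / L * L       ≡⟨ +-comm L (N / L * L) ⟩
      N / L * L + L       ∎

  q^L^[N/L]≤ : ∀ N → (q ^ L) ^ (N / L) ≤ q ^ N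
  q^L^[N/L]≤ N = begin
    (q ^ L) ^ (N / L)   ≡⟨ ^-*-assoc q L (N / L) ⟩
    q ^ (L * (N / L))   ≡⟨ cong (q ^_) (*-comm L (N / L)) ⟩
    q ^ (N / L * L)     ≤⟨ ^-monoʳ-≤ q {{m*n≢0 (suc a) L}} (m/n*n≤m N L) ⟩
    q ^ N               ∎

  long-run : ∀ N → N₀ ≤ N → 3 * p ^ N * a ^ (N / L) ≤ suc a ^ (N / L) * q ^ N
  long-run N N₀≤N = begin
    3 * p ^ N * a ^ J                   ≤⟨ *-monoˡ-≤ (a ^ J) (*-monoʳ-≤ 3 (p^N≤ N)) ⟩
    3 * ((p ^ L) ^ J * p ^ L) * a ^ J   ≡⟨ regroup (p ^ L) ((p ^ L) ^ J) (a ^ J) ⟩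
    3 * p ^ L * (a ^ J * (p ^ L) ^ J)   ≡⟨ cong (3 * p ^ L *_) (^-distribʳ-* a (p ^ L) J) ⟨
    3 * p ^ L * (a * p ^ L) ^ J         ≤⟨ pow-outgrows-linear (3 * p ^ L) J (pow-ratio-gap a L) J≥ ⟩
    (suc a * q ^ L) ^ J                 ≡⟨ ^-distribʳ-* (suc a) (q ^ L) J ⟩
    suc a ^ J * (q ^ L) ^ J             ≤⟨ *-monoʳ-≤ (suc a ^ J) (q^L^[N/L]≤ N) ⟩
    suc a ^ J * q ^ N                   ∎
    where
    J = N / L
    instance
      p^L≢0 : NonZero (p ^ L)
      p^L≢0 = m^n≢0 p L
      a*p^L≢0 : NonZero (a * p ^ L)
      a*p^L≢0 = m*n≢0 a (p ^ L)
    J≥ : 3 * p ^ L * (a * p ^ L) ≤ J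
    J≥ = subst (_≤ J) (m*n/n≡m _ L) (/-monoˡ-≤ L N₀≤N)
    regroup : ∀ x y z → 3 * (y * x) * z ≡ 3 * x * (z * y)
    regroup = solve-∀

potential-after-claim : ∀ b {Φ x ΣR Σc c d H} → Φ ≤ x + ΣR + c * suc H → suc b * x ≤ Σc + c * d →
                        Φ + b * x ≤ Σc + ΣR + c * suc (d + H)
potential-after-claim b {Φ} {x} {ΣR} {Σc} {c} {d} {H} Φ≤ K1x≤ = begin
  Φ + b * x                      ≤⟨ +-monoˡ-≤ (b * x) Φ≤ ⟩
  x + ΣR + c * suc H + b * x     ≡⟨ collect x ΣR (c * suc H) b ⟩
  suc b * x + ΣR + c * suc H     ≤⟨ +-monoˡ-≤ (c * suc H) (+-monoˡ-≤ ΣR K1x≤) ⟩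
  Σc + c * d + ΣR + c * suc H    ≡⟨ regroup Σc c d ΣR H ⟩
  Σc + ΣR + c * suc (d + H)      ∎
  where
  collect : ∀ x ΣR cH b → x + ΣR + cH + b * x ≡ suc b * x + ΣR + cH
  collect = solve-∀
  regroup : ∀ Σc c d ΣR H → Σc + c * d + ΣR + c * suc H ≡ Σc + ΣR + c * suc (d + H)
  regroup = solve-∀

potential-after-reply : ∀ b {Φ x Σ Σ' c s} → Φ + b * x ≤ Σ + c → Σ ≤ Σ' + s * x → s ≤ b → Φ ≤ Σ' + c
potential-after-reply b {Φ} {x} {Σ} {Σ'} {c} {s} Φ+bx≤ Σ≤ s≤b = +-cancelʳ-≤ (b * x) Φ (Σ' + c) (begin
  Φ + b * x          ≤⟨ Φ+bx≤ ⟩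
  Σ + c              ≤⟨ +-monoˡ-≤ c Σ≤ ⟩
  Σ' + s * x + c     ≤⟨ +-monoˡ-≤ c (+-monoʳ-≤ Σ' (*-monoˡ-≤ x s≤b)) ⟩
  Σ' + b * x + c     ≡⟨ +-comm-right Σ' (b * x) c ⟩
  Σ' + c + b * x     ∎)
  where
  +-comm-right : ∀ a a' a'' → a + a' + a'' ≡ a + a'' + a'
  +-comm-right = solve-∀

-- Addresses, trees and the game

infix 4 _≼_ _≼?_

_≼_ : Addr → Addr → Set
_≼_ = Prefix _≡_

_≼?_ : ∀ a a' → Dec (a ≼ a')
_≼?_ = prefix? _≟_

≼-refl : ∀ {a} → a ≼ a
≼-refl = fromPointwise (Pointwise.refl refl)

≼-trans : ∀ {a a' a''} → a ≼ a' → a' ≼ a'' → a ≼ a''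
≼-trans = Prefix.trans trans

≼-∷ʳ : ∀ a j → a ≼ a ∷ʳ j
≼-∷ʳ a j = ≼-refl ++ᵖ (j ∷ [])

≼-comparable : ∀ {a a' c} → a ≼ c → a' ≼ c → a ≼ a' ⊎ a' ≼ a
≼-comparable []         _          = inj₁ []
≼-comparable (_ ∷ _)    []         = inj₂ []
≼-comparable (refl ∷ p) (refl ∷ q) = Sum.map (refl ∷_) (refl ∷_) (≼-comparable p q)

∷ʳ⋠ : ∀ a j → ¬ a ∷ʳ j ≼ a
∷ʳ⋠ []      j ()
∷ʳ⋠ (x ∷ a) j (refl ∷ p) = ∷ʳ⋠ a j p

≼-∷ʳ⁻ : ∀ {a'} a j → a' ≼ a ∷ʳ j → a' ≼ a ⊎ a' ≡ a ∷ʳ j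
≼-∷ʳ⁻ {[]}     a       j _          = inj₁ []
≼-∷ʳ⁻ {x ∷ a'} []      j (refl ∷ []) = inj₂ refl
≼-∷ʳ⁻ {x ∷ a'} (y ∷ a) j (refl ∷ p) = Sum.map (refl ∷_) (cong (y ∷_)) (≼-∷ʳ⁻ a j p)

∷ʳ-≼-injective : ∀ a {i j} → a ∷ʳ i ≼ a ∷ʳ j → i ≡ j
∷ʳ-≼-injective []      (i≡j ∷ _) = i≡j
∷ʳ-≼-injective (x ∷ a) (_ ∷ p)   = ∷ʳ-≼-injective a p

Apart : Addr → Addr → Set
Apart a a' = ¬ a ≼ a' × ¬ a' ≼ a

Apart-∷ʳ : ∀ {a a'} j → Apart a a' → Apart (a ∷ʳ j) a'
Apart-∷ʳ {a} j (a⋠a' , a'⋠a) =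
  (λ p → a⋠a' (≼-trans (≼-∷ʳ a j) p)) ,
  (λ p → Sum.[ a'⋠a , (λ { refl → a⋠a' (≼-∷ʳ a j) }) ] (≼-∷ʳ⁻ a j p))

Apart-siblings : ∀ a {i j} → i < j → Apart (a ∷ʳ i) (a ∷ʳ j)
Apart-siblings a i<j =
  (λ p → <-irrefl (∷ʳ-≼-injective a p) i<j) , (λ p → <-irrefl (sym (∷ʳ-≼-injective a p)) i<j)

module _ {A : Set} where

  sum-map-─ : ∀ (g : A → ℕ) {x xs} (x∈ : x ∈ xs) → sum (map g xs) ≡ g x + sum (map g (xs ─ x∈))
  sum-map-─ g (here refl) = refl
  sum-map-─ g {x} {y ∷ xs} (there x∈) = trans (cong (g y +_) (sum-map-─ g x∈)) (+-comm-middle (g y) (g x) _)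
    where
    +-comm-middle : ∀ a b c → a + (b + c) ≡ b + (a + c)
    +-comm-middle = solve-∀

  sum-map-++ : ∀ (g : A → ℕ) xs ys → sum (map g (xs ++ ys)) ≡ sum (map g xs) + sum (map g ys)
  sum-map-++ g xs ys = trans (cong sum (map-++ g xs ys)) (sum-++ (map g xs) (map g ys))

  ─-AllPairs : ∀ {R : A → A → Set} → (∀ {a a'} → R a a' → R a' a) →
               ∀ {x xs} (x∈ : x ∈ xs) → AllPairs R xs → All (R x) (xs ─ x∈) × AllPairs R (xs ─ x∈)
  ─-AllPairs sym (here refl) (Rx ∷ Rs) = Rx , Rs
  ─-AllPairs sym (there x∈) (Ry ∷ Rs) with ─-AllPairs sym x∈ Rs
  ... | Rx , Rs' = sym (All.lookup Ry x∈) ∷ Rx , ─⁺ x∈ Ry ∷ Rs'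

mutual
  size : RTree → ℕ
  size (node cs) = suc (sizes cs)

  sizes : List RTree → ℕ
  sizes []       = 0
  sizes (c ∷ cs) = size c + sizes cs

mutual
  at-++ : ∀ t a a' {s} → at t a ≡ just s → at t (a ++ a') ≡ at s a'
  at-++ t         []      a' refl = refl
  at-++ (node ts) (i ∷ a) a' eq   = atList-++ ts i a a' eq

  atList-++ : ∀ ts i a a' {s} → atList ts i a ≡ just s → atList ts i (a ++ a') ≡ at s a'
  atList-++ []       i       a a' ()
  atList-++ (t ∷ ts) zero    a a' eq = at-++ t a a' eq
  atList-++ (t ∷ ts) (suc i) a a' eq = atList-++ ts i a a' eq

size-children : ∀ s → size s ≡ suc (sizes (children s))
size-children (node _) = refl

at-child : ∀ s j → at s (j ∷ []) ≡ atList (children s) j []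
at-child (node _) j = refl

module _ {t : RTree} {b : ℕ} {W W' : List Edge → Set} (W⇒W' : ∀ {M} → W M → W' M) where
  private
    module G  = Game t b W
    module G' = Game t b W'

  mutual
    MakerToMove-mono : ∀ {M B} → G.MakerToMove M B → G'.MakerToMove M B
    MakerToMove-mono (G.done w)              = G'.done (W⇒W' w)
    MakerToMove-mono (G.move e free conn next) = G'.move e free conn (BreakerToMove-mono next)

    BreakerToMove-mono : ∀ {M B} → G.BreakerToMove M B → G'.BreakerToMove M B
    BreakerToMove-mono (G.done w)   = G'.done (W⇒W' w)
    BreakerToMove-mono (G.reply next) = G'.reply λ S move → MakerToMove-mono (next S move)

Attached : List Edge → Addr → Set
Attached M v = InGraph M v ⊎ (M ≡ [] × v ≡ [])

Attached-∷ : ∀ {M p v} i → Attached M v → Attached M p → InGraph ((p , i) ∷ M) v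
Attached-∷ i (inj₁ v∈M)         _                  = there v∈M
Attached-∷ i (inj₂ (refl , _))    (inj₁ ())
Attached-∷ i (inj₂ (refl , refl)) (inj₂ (_ , refl)) = here upper

Connected-∷ : ∀ {M} e → Connected M → Attached M (proj₁ e) → Connected (e ∷ M)
Connected-∷ e _ (inj₂ (refl , _)) _ _ (here refl) (here refl) = ε
Connected-∷ {M} e@(p , _) conn (inj₁ p∈M) = connect
  where
  g    = proj₁ (find p∈M)
  g∈M  = proj₁ (proj₂ (find p∈M))
  p∈g  = proj₂ (proj₂ (find p∈M))
  widen : ∀ {f f'} → Star (Touch M) f f' → Star (Touch (e ∷ M)) f f'
  widen = gmap id λ (f∈ , f'∈ , v , f∋v , f'∋v) → there f∈ , there f'∈ , v , f∋v , f'∋v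
  connect : Connected (e ∷ M)
  connect _ _ (here refl) (here refl) = ε
  connect _ f (here refl) (there f∈)  = (here refl , there g∈M , p , upper , p∈g) ◅ widen (conn g f g∈M f∈)
  connect f _ (there f∈)  (here refl) =
    widen (conn f g f∈ g∈M) ◅◅ ((there g∈M , here refl , p , p∈g , upper) ◅ ε)
  connect f f' (there f∈) (there f'∈) = widen (conn f f' f∈ f'∈)

BreakerMove-length : ∀ {t b M B S} → BreakerMove t b M B S → length S ≤ b
BreakerMove-length (_ , _ , inj₁ refl)       = ≤-refl
BreakerMove-length (_ , _ , inj₂ (|S|<b , _)) = <⇒≤ |S|<b

-- The potential

⟦_⟧ : {P : Set} → Dec P → ℕ
⟦ yes _ ⟧ = 1
⟦ no _ ⟧  = 0

module Potential (k' C : ℕ) where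

  b K1 k : ℕ
  b  = suc k'
  K1 = suc b
  k  = suc K1

  grow : ℕ → ℕ
  grow m = (k * m + C) / K1

  grow-mono : ∀ {m n} → m ≤ n → grow m ≤ grow n
  grow-mono m≤n = /-monoˡ-≤ K1 (+-monoˡ-≤ C (*-monoʳ-≤ k m≤n))

  K1*grow≤ : ∀ m → K1 * grow m ≤ k * m + C
  K1*grow≤ m = ≤-trans (≤-reflexive (*-comm K1 (grow m))) (m/n*n≤m (k * m + C) K1)

  ≤grow : ∀ {y m} → K1 * y ≤ k * m + C → y ≤ grow m
  ≤grow {y} K1y≤ = subst (_≤ _) (m*n/n≡m y K1) (/-monoˡ-≤ K1 (≤-trans (≤-reflexive (*-comm y K1)) K1y≤))

  weight : ℕ → ℕ → ℕ
  weight n m with k ≤? n | K1 ≤? n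
  ... | yes _ | _     = grow m
  ... | no _  | yes _ = m
  ... | no _  | no _  = 0

  mutual
    Φ : RTree → ℕ
    Φ (node [])       = 0
    Φ (node (c ∷ cs)) = weight (suc (length cs)) (minΦ c cs)

    minΦ : RTree → List RTree → ℕ
    minΦ c []       = Φ c
    minΦ c (d ∷ ds) = Φ c ⊓ minΦ d ds

  cappedSum : ℕ → List RTree → ℕ
  cappedSum x cs = sum (map (λ c → x ⊓ Φ c) cs)

  length*⊓minΦ≤cappedSum : ∀ x c cs → suc (length cs) * (x ⊓ minΦ c cs) ≤ cappedSum x (c ∷ cs)
  length*⊓minΦ≤cappedSum x c [] = ≤-refl
  length*⊓minΦ≤cappedSum x c (d ∷ ds) =
    +-mono-≤ (⊓-monoʳ-≤ x (m⊓n≤m (Φ c) (minΦ d ds)))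
      (≤-trans (*-monoʳ-≤ (suc (length ds)) (⊓-monoʳ-≤ x (m⊓n≤n (Φ c) (minΦ d ds))))
               (length*⊓minΦ≤cappedSum x d ds))

  K1*≤k*⊓+C : ∀ {x m} → x ≤ grow m → K1 * x ≤ k * (x ⊓ m) + C
  K1*≤k*⊓+C {x} {m} x≤ with x ≤? m
  ... | yes x≤m = begin
    K1 * x          ≤⟨ *-monoˡ-≤ x (n≤1+n K1) ⟩
    k * x           ≡⟨ cong (k *_) (m≤n⇒m⊓n≡m x≤m) ⟨
    k * (x ⊓ m)     ≤⟨ m≤m+n _ C ⟩
    k * (x ⊓ m) + C ∎
  ... | no x≰m = begin
    K1 * x          ≤⟨ *-monoʳ-≤ K1 x≤ ⟩
    K1 * grow m     ≤⟨ K1*grow≤ m ⟩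
    k * m + C       ≡⟨ cong (λ z → k * z + C) (m≥n⇒m⊓n≡n (<⇒≤ (≰⇒> x≰m))) ⟨
    k * (x ⊓ m) + C ∎

  K1*≤cappedSum : ∀ x s → x ≤ Φ s → K1 * x ≤ cappedSum x (children s) + C * ⟦ k ≤? length (children s) ⟧
  K1*≤cappedSum x (node []) x≤0 = ≤-trans (*-monoʳ-≤ K1 x≤0) (≤-trans (≤-reflexive (*-zeroʳ K1)) z≤n)
  K1*≤cappedSum x (node (c ∷ cs)) x≤ with k ≤? suc (length cs) | K1 ≤? suc (length cs)
  ... | yes k≤n | _ = begin
    K1 * x                        ≤⟨ K1*≤k*⊓+C x≤ ⟩
    k * (x ⊓ m) + C               ≤⟨ +-monoˡ-≤ C (≤-trans (*-monoˡ-≤ (x ⊓ m) k≤n) (length*⊓minΦ≤cappedSum x c cs)) ⟩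
    cappedSum x (c ∷ cs) + C      ≡⟨ cong (cappedSum x (c ∷ cs) +_) (*-identityʳ C) ⟨
    cappedSum x (c ∷ cs) + C * 1  ∎
    where m = minΦ c cs
  ... | no _ | yes K1≤n = begin
    K1 * x                        ≡⟨ cong (K1 *_) (m≤n⇒m⊓n≡m x≤) ⟨
    K1 * (x ⊓ minΦ c cs)          ≤⟨ *-monoˡ-≤ _ K1≤n ⟩
    suc (length cs) * (x ⊓ minΦ c cs) ≤⟨ length*⊓minΦ≤cappedSum x c cs ⟩
    cappedSum x (c ∷ cs)          ≤⟨ m≤m+n _ _ ⟩
    cappedSum x (c ∷ cs) + C * 0  ∎
  ... | no _ | no _ = ≤-trans (*-monoʳ-≤ K1 x≤) (≤-trans (≤-reflexive (*-zeroʳ K1)) z≤n)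

  k^j*K1^d≤grow^j+C : ∀ j d → K1 ^ (j + d) ≤ C → k ^ j * K1 ^ d ≤ fold 0 grow j + C
  k^j*K1^d≤grow^j+C zero d K1^d≤C = ≤-trans (≤-reflexive (*-identityˡ (K1 ^ d))) K1^d≤C
  k^j*K1^d≤grow^j+C (suc j) d K1^[1+j+d]≤C = begin
    E                  ≤⟨ m≤n+m∸n E C ⟩
    C + (E ∸ C)        ≡⟨ +-comm C (E ∸ C) ⟩
    (E ∸ C) + C        ≤⟨ +-monoˡ-≤ C (≤grow {m = g} K1[E∸C]≤) ⟩
    grow g + C         ∎
    where
    g = fold 0 grow j
    E = k ^ suc j * K1 ^ d
    IH : k ^ j * K1 ^ suc d ≤ g + C
    IH = k^j*K1^d≤grow^j+C j (suc d) (subst (λ e → K1 ^ e ≤ C) (sym (+-suc j d)) K1^[1+j+d]≤C)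
    K1E≤ : K1 * E ≤ (k * g + C) + K1 * C
    K1E≤ = begin
      K1 * E                      ≡⟨ shift K1 (k ^ j) (K1 ^ d) ⟩
      k * (k ^ j * K1 ^ suc d)    ≤⟨ *-monoʳ-≤ k IH ⟩
      k * (g + C)                 ≡⟨ expand K1 g C ⟩
      (k * g + C) + K1 * C        ∎
      where
      shift : ∀ K1 x y → K1 * (suc K1 * x * y) ≡ suc K1 * (x * (K1 * y))
      shift = solve-∀
      expand : ∀ K1 g C → suc K1 * (g + C) ≡ (suc K1 * g + C) + K1 * C
      expand = solve-∀
    K1[E∸C]≤ : K1 * (E ∸ C) ≤ k * g + C
    K1[E∸C]≤ = begin
      K1 * (E ∸ C)       ≡⟨ *-distribˡ-∸ K1 E C ⟩
      K1 * E ∸ K1 * C    ≤⟨ m≤n+o⇒m∸n≤o (K1 * E) (K1 * C) (≤-trans K1E≤ (≤-reflexive (+-comm _ (K1 * C)))) ⟩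
      k * g + C          ∎

  module LowerBound (L' : ℕ) where

    L : ℕ
    L = suc L'

    pathBound : ℕ → ℕ → ℕ
    pathBound zero    r       = 0
    pathBound (suc n) zero    = grow (pathBound n L')
    pathBound (suc n) (suc r) = grow (pathBound n L') ⊓ pathBound n r

    pathBound≤grow : ∀ {n} r → pathBound (suc n) r ≤ grow (pathBound n L')
    pathBound≤grow zero    = ≤-refl
    pathBound≤grow (suc r) = m⊓n≤m _ _

    drop-last : ∀ {n x} r → L' + x + r ≤ n + L' → x + L' ≤ n + L'
    drop-last {x = x} r le = ≤-trans (≤-reflexive (+-comm x L')) (≤-trans (m≤m+n _ r) le)

    grow^j≤pathBound : ∀ n j r → j * L + r ≤ n + L' → fold 0 grow j ≤ pathBound n r
    grow^j≤pathBound n zero r _ = z≤n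
    grow^j≤pathBound zero (suc j) r le = ⊥-elim (1+n≰n (≤-trans (s≤s (≤-trans (m≤m+n L' (j * L)) (m≤m+n _ r))) le))
    grow^j≤pathBound (suc n) (suc j) zero le =
      grow-mono (grow^j≤pathBound n j L' (drop-last zero (s≤s⁻¹ le)))
    grow^j≤pathBound (suc n) (suc j) (suc r) le =
      ⊓-glb (grow-mono (grow^j≤pathBound n j L' (drop-last (suc r) le')))
            (grow^j≤pathBound n (suc j) r (≤-trans (≤-reflexive (sym (+-suc (L' + j * L) r))) le'))
      where
      le' = s≤s⁻¹ le

    NLTree-children : ∀ {n} cs → NLTree k (suc n) L (node cs) → All (NLTree k n L) cs
    NLTree-children cs (balanced , no-light , no-path) =
      subtrees cs (λ i a s eq leaf → suc-injective (balanced (i ∷ a) s eq leaf))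
                  (λ i a → no-light (i ∷ a)) (λ i a → no-path (i ∷ a))
      where
      subtrees : ∀ {n} ds →
        (∀ i a s → atList ds i a ≡ just s → children s ≡ [] → length a ≡ n) →
        (∀ i a s → atList ds i a ≡ just s → ¬ Light K1 s) →
        (∀ i a s → atList ds i a ≡ just s → ¬ LightPath k L s) →
        All (NLTree k n L) ds
      subtrees [] _ _ _ = []
      subtrees (d ∷ ds) bal nl np =
        (bal 0 , nl 0 , np 0) ∷ subtrees ds (λ i → bal (suc i)) (λ i → nl (suc i)) (λ i → np (suc i))

    no-light-path-below : ∀ {n} cs → All (NLTree k n L) cs → ¬ Any (LightPath k L) cs
    no-light-path-below cs nlts = All¬⇒¬Any (All.map (λ (_ , _ , no-path) → no-path [] _ refl) nlts)

    mutual
      pathBound≤Φ : ∀ n r s → NLTree k n L s → ¬ LightPath k (suc r) s → pathBound n r ≤ Φ s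
      pathBound≤Φ zero r s _ _ = z≤n
      pathBound≤Φ (suc n) r (node []) (balanced , _) _ with balanced [] (node []) refl refl
      ... | ()
      pathBound≤Φ (suc n) r (node (c ∷ cs)) nlt@(_ , no-light , _) no-path
        with k ≤? suc (length cs) | K1 ≤? suc (length cs)
      ... | yes _ | _ =
        ≤-trans (pathBound≤grow r) (grow-mono (pathBound≤minΦ n L' c cs kids (no-light-path-below (c ∷ cs) kids)))
        where kids = NLTree-children (c ∷ cs) nlt
      ... | no k≰n | yes _ = light-case r no-path
        where
        kids = NLTree-children (c ∷ cs) nlt
        light : Light k (node (c ∷ cs))
        light = s≤s z≤n , ≰⇒> k≰n
        light-case : ∀ r → ¬ LightPath k (suc r) (node (c ∷ cs)) → pathBound (suc n) r ≤ minΦ c cs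
        light-case zero no-path = ⊥-elim (no-path (light , inj₁ refl))
        light-case (suc r) no-path =
          ≤-trans (m⊓n≤n _ _) (pathBound≤minΦ n r c cs kids (λ below → no-path (light , inj₂ below)))
      ... | no _ | no K1≰n = ⊥-elim (no-light [] _ refl (s≤s z≤n , ≰⇒> K1≰n))

      pathBound≤minΦ : ∀ n r c cs → All (NLTree k n L) (c ∷ cs) → ¬ Any (LightPath k (suc r)) (c ∷ cs) →
                       pathBound n r ≤ minΦ c cs
      pathBound≤minΦ n r c [] (nlt ∷ []) no-path = pathBound≤Φ n r c nlt (λ p → no-path (here p))
      pathBound≤minΦ n r c (d ∷ ds) (nlt ∷ nlts) no-path =
        ⊓-glb (pathBound≤Φ n r c nlt (λ p → no-path (here p)))
              (pathBound≤minΦ n r d ds nlts (λ p → no-path (there p)))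

    k^J≤Φ+C : ∀ J N t → NLTree k N L t → J * L ≤ N → K1 ^ J ≤ C → k ^ J ≤ Φ t + C
    k^J≤Φ+C J N t nlt@(_ , _ , no-path) JL≤N K1^J≤C = begin
      k ^ J                 ≡⟨ *-identityʳ (k ^ J) ⟨
      k ^ J * K1 ^ 0        ≤⟨ k^j*K1^d≤grow^j+C J 0 (subst (λ e → K1 ^ e ≤ C) (sym (+-identityʳ J)) K1^J≤C) ⟩
      fold 0 grow J + C     ≤⟨ +-monoˡ-≤ C (grow^j≤pathBound N J L' (+-monoˡ-≤ L' JL≤N)) ⟩
      pathBound N L' + C    ≤⟨ +-monoˡ-≤ C (pathBound≤Φ N L' t nlt (no-path [] t refl)) ⟩
      Φ t + C               ∎

-- Maker's strategy

lowerEnd : Edge → Addr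
lowerEnd (p , i) = p ∷ʳ i

record Token : Set where
  constructor token
  field
    parent  : Addr
    index   : ℕ
    subtree : RTree
    value   : ℕ

  edge : Edge
  edge = parent , index

  vertex : Addr
  vertex = parent ∷ʳ index
open Token public

Within : Edge → Token → Set
Within f u = vertex u ≼ lowerEnd f

within? : ∀ f u → Dec (Within f u)
within? f u = vertex u ≼? lowerEnd f

Disjoint : Token → Token → Set
Disjoint u v = Apart (vertex u) (vertex v)

Disjoint-sym : ∀ {u v} → Disjoint u v → Disjoint v u
Disjoint-sym = swap

within-unique : ∀ {f u v} → Disjoint u v → Within f u → ¬ Within f v
within-unique (u⋠v , v⋠u) f∈u f∈v = Sum.[ u⋠v , v⋠u ] (≼-comparable f∈u f∈v)

Σvalue : List Token → ℕ
Σvalue T = sum (map value T)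

dropWithin : Edge → List Token → List Token
dropWithin f []      = []
dropWithin f (u ∷ T) with within? f u
... | yes _ = dropWithin f T
... | no _  = u ∷ dropWithin f T

dropWithin-All : ∀ {P : Token → Set} f {T} → All P T → All P (dropWithin f T)
dropWithin-All f {[]}    []       = []
dropWithin-All f {u ∷ T} (pu ∷ ps) with within? f u
... | yes _ = dropWithin-All f ps
... | no _  = pu ∷ dropWithin-All f ps

dropWithin-AllPairs : ∀ {R : Token → Token → Set} f {T} → AllPairs R T → AllPairs R (dropWithin f T)
dropWithin-AllPairs f {[]}    []         = []
dropWithin-AllPairs f {u ∷ T} (Ru ∷ Rs) with within? f u
... | yes _ = dropWithin-AllPairs f Rs
... | no _  = dropWithin-All f Ru ∷ dropWithin-AllPairs f Rs

dropWithin-outside : ∀ f T → All (λ u → ¬ Within f u) (dropWithin f T)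
dropWithin-outside f []      = []
dropWithin-outside f (u ∷ T) with within? f u
... | yes _   = dropWithin-outside f T
... | no f∉u  = f∉u ∷ dropWithin-outside f T

dropWithin-id : ∀ f {T} → All (λ u → ¬ Within f u) T → dropWithin f T ≡ T
dropWithin-id f {[]}    []            = refl
dropWithin-id f {u ∷ T} (f∉u ∷ f∉T) with within? f u
... | yes f∈u = ⊥-elim (f∉u f∈u)
... | no _    = cong (u ∷_) (dropWithin-id f f∉T)

sum-dropWithin≤ : ∀ (g : Token → ℕ) f T → sum (map g (dropWithin f T)) ≤ sum (map g T)
sum-dropWithin≤ g f []      = z≤n
sum-dropWithin≤ g f (u ∷ T) with within? f u
... | yes _ = ≤-trans (sum-dropWithin≤ g f T) (m≤n+m _ (g u))
... | no _  = +-monoʳ-≤ (g u) (sum-dropWithin≤ g f T)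

Σvalue-dropWithin : ∀ f {x T} → AllPairs Disjoint T → All (λ u → value u ≤ x) T →
                    Σvalue T ≤ Σvalue (dropWithin f T) + x
Σvalue-dropWithin f {x} {[]}    []         []          = z≤n
Σvalue-dropWithin f {x} {u ∷ T} (du ∷ ds) (u≤x ∷ T≤x) with within? f u
... | yes f∈u = begin
  value u + Σvalue T                 ≤⟨ +-monoˡ-≤ (Σvalue T) u≤x ⟩
  x + Σvalue T                       ≡⟨ +-comm x (Σvalue T) ⟩
  Σvalue T + x                       ≡⟨ cong (λ T' → Σvalue T' + x) (dropWithin-id f only-u) ⟨
  Σvalue (dropWithin f T) + x        ∎
  where
  only-u : All (λ v → ¬ Within f v) T
  only-u = All.map (λ {v} d → within-unique {f} {u} {v} d f∈u) du
... | no _ = begin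
  value u + Σvalue T                 ≤⟨ +-monoʳ-≤ (value u) (Σvalue-dropWithin f ds T≤x) ⟩
  value u + (Σvalue (dropWithin f T) + x) ≡⟨ +-assoc (value u) _ x ⟨
  value u + Σvalue (dropWithin f T) + x   ∎

survivors : List Edge → List Token → List Token
survivors []      T = T
survivors (f ∷ S) T = survivors S (dropWithin f T)

survivors-All : ∀ {P : Token → Set} S {T} → All P T → All P (survivors S T)
survivors-All []      ps = ps
survivors-All (f ∷ S) ps = survivors-All S (dropWithin-All f ps)

survivors-AllPairs : ∀ {R : Token → Token → Set} S {T} → AllPairs R T → AllPairs R (survivors S T)
survivors-AllPairs []      Rs = Rs
survivors-AllPairs (f ∷ S) Rs = survivors-AllPairs S (dropWithin-AllPairs f Rs)

survivors-outside : ∀ S T → All (λ u → ∀ {f} → f ∈ S → ¬ Within f u) (survivors S T)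
survivors-outside []      T = All.tabulate λ _ ()
survivors-outside (f ∷ S) T =
  All.map (λ {u} → outside-both {u})
    (All.zip (survivors-All S (dropWithin-outside f T) , survivors-outside S (dropWithin f T)))
  where
  outside-both : ∀ {u : Token} → ¬ Within f u × (∀ {f'} → f' ∈ S → ¬ Within f' u) →
                 ∀ {f'} → f' ∈ f ∷ S → ¬ Within f' u
  outside-both (f∉u , _)   (here refl) = f∉u
  outside-both (_ , S∉u) (there f'∈S) = S∉u f'∈S

sum-survivors≤ : ∀ (g : Token → ℕ) S T → sum (map g (survivors S T)) ≤ sum (map g T)
sum-survivors≤ g []      T = ≤-refl
sum-survivors≤ g (f ∷ S) T = ≤-trans (sum-survivors≤ g S (dropWithin f T)) (sum-dropWithin≤ g f T)

Σvalue-survivors : ∀ S {x T} → AllPairs Disjoint T → All (λ u → value u ≤ x) T →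
                   Σvalue T ≤ Σvalue (survivors S T) + length S * x
Σvalue-survivors []      {x} {T} _  _   = ≤-reflexive (sym (+-identityʳ (Σvalue T)))
Σvalue-survivors (f ∷ S) {x} {T} ds T≤x = begin
  Σvalue T                          ≤⟨ Σvalue-dropWithin f ds T≤x ⟩
  Σvalue (dropWithin f T) + x       ≤⟨ +-monoˡ-≤ x (Σvalue-survivors S (dropWithin-AllPairs f ds) (dropWithin-All f T≤x)) ⟩
  Σ' + length S * x + x             ≡⟨ +-assoc Σ' (length S * x) x ⟩
  Σ' + (length S * x + x)           ≡⟨ cong (Σ' +_) (+-comm (length S * x) x) ⟩
  Σ' + (x + length S * x)           ∎
  where
  Σ' = Σvalue (survivors S (dropWithin f T))

⟦⟧≤1 : {P : Set} (d : Dec P) → ⟦ d ⟧ ≤ 1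
⟦⟧≤1 (yes _) = ≤-refl
⟦⟧≤1 (no _)  = z≤n

consIf : {P : Set} → Dec P → Addr → List Addr → List Addr
consIf (yes _) a as = a ∷ as
consIf (no _)  _ as = as

length-consIf : {P : Set} (d : Dec P) → ∀ a as → length (consIf d a as) ≡ ⟦ d ⟧ + length as
length-consIf (yes _) _ _ = refl
length-consIf (no _)  _ _ = refl

argmax-value∈ : ∀ u T → argmax value u T ∈ u ∷ T
argmax-value∈ u T with argmax-sel value u T
... | inj₁ ≡u  = here ≡u
... | inj₂ ∈T = there ∈T

value≤argmax : ∀ u T → All (λ v → value v ≤ value (argmax value u T)) (u ∷ T)
value≤argmax u T = f[⊥]≤f[argmax] {f = value} u T ∷ f[xs]≤f[argmax] {f = value} u T

module Strategy (k' C : ℕ) (t : RTree) where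
  open Potential k' C

  record Fresh (M B : List Edge) (u : Token) : Set where
    field
      located     : at t (vertex u) ≡ just (subtree u)
      bounded     : value u ≤ Φ (subtree u)
      maker-out   : ∀ {f} → f ∈ M → ¬ Within f u
      breaker-out : ∀ {f} → f ∈ B → ¬ Within f u
      attached    : Attached M (parent u)
  open Fresh

  Claimed : List Edge → Addr → Set
  Claimed M h = Any (λ f → lowerEnd f ≡ h) M

  record Structure (M B : List Edge) (T : List Token) (Hs : List Addr) : Set where
    field
      fresh     : All (Fresh M B) T
      disjoint  : AllPairs Disjoint T
      unique    : Unique Hs
      heavy     : All (λ h → Claimed M h × HeavyIn t k h) Hs
      connected : Connected M

  MakerInvariant BreakerInvariant : List Edge → List Edge → List Token → List Addr → Set
  MakerInvariant M B T Hs = Structure M B T Hs × Φ t ≤ Σvalue T + C * suc (length Hs)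
  BreakerInvariant M B T Hs = Structure M B T Hs ×
    Σ ℕ λ x → All (λ u → value u ≤ x) T × Φ t + b * x ≤ Σvalue T + C * suc (length Hs)

  Reaches : List Edge → Set
  Reaches M = Σ (List Addr) λ vs → Unique vs × All (λ v → InGraph M v × HeavyIn t k v) vs
              × Φ t ≤ C * suc (length vs)

  open Game t b Reaches

  Σsize : List Token → ℕ
  Σsize T = sum (map (λ u → size (subtree u)) T)

  childTokens : Addr → ℕ → ℕ → List RTree → List Token
  childTokens a x i []       = []
  childTokens a x i (c ∷ cs) = token a i c (x ⊓ Φ c) ∷ childTokens a x (suc i) cs

  Σvalue-childTokens : ∀ a x i cs → Σvalue (childTokens a x i cs) ≡ cappedSum x cs
  Σvalue-childTokens a x i []       = refl
  Σvalue-childTokens a x i (c ∷ cs) = cong (x ⊓ Φ c +_) (Σvalue-childTokens a x (suc i) cs)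

  Σsize-childTokens : ∀ a x i cs → Σsize (childTokens a x i cs) ≡ sizes cs
  Σsize-childTokens a x i []       = refl
  Σsize-childTokens a x i (c ∷ cs) = cong (size c +_) (Σsize-childTokens a x (suc i) cs)

  childTokens-≤ : ∀ a x i cs → All (λ u → value u ≤ x) (childTokens a x i cs)
  childTokens-≤ a x i []       = []
  childTokens-≤ a x i (c ∷ cs) = m⊓n≤m x (Φ c) ∷ childTokens-≤ a x (suc i) cs

  childTokens-below : ∀ a x i cs → All (λ u → parent u ≡ a × i ≤ index u) (childTokens a x i cs)
  childTokens-below a x i []       = []
  childTokens-below a x i (c ∷ cs) =
    (refl , ≤-refl) ∷ All.map (map₂ (≤-trans (n≤1+n i))) (childTokens-below a x (suc i) cs)

  childTokens-disjoint : ∀ a x i cs → AllPairs Disjoint (childTokens a x i cs)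
  childTokens-disjoint a x i []       = []
  childTokens-disjoint a x i (c ∷ cs) =
    All.map (λ {v} → later {v}) (childTokens-below a x (suc i) cs) ∷ childTokens-disjoint a x (suc i) cs
    where
    later : ∀ {v} → parent v ≡ a × suc i ≤ index v → Disjoint (token a i c (x ⊓ Φ c)) v
    later {token _ _ _ _} (refl , i<j) = Apart-siblings a i<j

  childTokens-fresh : ∀ a x i cs {M B} →
    (∀ j {c} → atList cs j [] ≡ just c → at t (a ∷ʳ (i + j)) ≡ just c) →
    (∀ {f} → f ∈ M → ∀ j → ¬ a ∷ʳ j ≼ lowerEnd f) →
    (∀ {f} → f ∈ B → ∀ j → ¬ a ∷ʳ j ≼ lowerEnd f) →
    Attached M a →
    All (Fresh M B) (childTokens a x i cs)
  childTokens-fresh a x i []       _        _         _           _        = []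
  childTokens-fresh a x i (c ∷ cs) located' maker-out' breaker-out' attached' =
    record { located     = subst (λ j → at t (a ∷ʳ j) ≡ just c) (+-identityʳ i) (located' 0 refl)
           ; bounded     = m⊓n≤n x (Φ c)
           ; maker-out   = λ f∈M → maker-out' f∈M i
           ; breaker-out = λ f∈B → breaker-out' f∈B i
           ; attached    = attached' }
    ∷ childTokens-fresh a x (suc i) cs
        (λ j {c'} eq → subst (λ j' → at t (a ∷ʳ j') ≡ just c') (+-suc i j) (located' (suc j) eq))
        maker-out' breaker-out' attached'

  module Claim {M B T Hs} (inv : MakerInvariant M B T Hs) {w} (w∈T : w ∈ T)
               (w-max : All (λ v → value v ≤ value w) T) where
    open Structure (proj₁ inv)

    e : Edge
    e = edge w
    x : ℕ
    x = value w
    a : Addr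
    a = vertex w
    cs : List RTree
    cs = children (subtree w)
    R : List Token
    R = T ─ w∈T
    new : List Token
    new = childTokens a x 0 cs ++ R
    heavy? : Dec (k ≤ length cs)
    heavy? = k ≤? length cs
    Hs' : List Addr
    Hs' = consIf heavy? a Hs

    w-fresh : Fresh M B w
    w-fresh = All.lookup fresh w∈T

    R-disjoint : All (Disjoint w) R × AllPairs Disjoint R
    R-disjoint = ─-AllPairs (λ {u} {v} → Disjoint-sym {u} {v}) w∈T disjoint

    free : Free t M B e
    free = (subtree w , located w-fresh)
         , (λ e∈M → maker-out w-fresh e∈M ≼-refl) , (λ e∈B → breaker-out w-fresh e∈B ≼-refl)

    e-connected : Connected (e ∷ M)
    e-connected = Connected-∷ e connected (attached w-fresh)

    children-fresh : All (Fresh (e ∷ M) B) (childTokens a x 0 cs)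
    children-fresh = childTokens-fresh a x 0 cs located' maker-out'
      (λ f∈B j p → breaker-out w-fresh f∈B (≼-trans (≼-∷ʳ a j) p)) (inj₁ (here lower))
      where
      located' : ∀ j {c} → atList cs j [] ≡ just c → at t (a ∷ʳ j) ≡ just c
      located' j eq = trans (at-++ t a (j ∷ []) (located w-fresh)) (trans (at-child (subtree w) j) eq)
      maker-out' : ∀ {f} → f ∈ e ∷ M → ∀ j → ¬ a ∷ʳ j ≼ lowerEnd f
      maker-out' (here refl)  j   = ∷ʳ⋠ a j
      maker-out' (there f∈M) j p = maker-out w-fresh f∈M (≼-trans (≼-∷ʳ a j) p)

    rest-fresh : ∀ {v} → Fresh M B v × Disjoint w v → Fresh (e ∷ M) B v
    rest-fresh (v-fresh , (_ , v⋠w)) = record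
      { located     = located v-fresh
      ; bounded     = bounded v-fresh
      ; maker-out   = λ { (here refl) → v⋠w ; (there f∈M) → maker-out v-fresh f∈M }
      ; breaker-out = breaker-out v-fresh
      ; attached    = inj₁ (Attached-∷ (index w) (attached v-fresh) (attached w-fresh)) }

    unclaimed : ∀ {h} → Claimed M h × HeavyIn t k h → a ≢ h
    unclaimed (claimed , _) a≡h with find claimed
    ... | f , f∈M , f↓≡h = maker-out w-fresh f∈M (subst (a ≼_) (trans a≡h (sym f↓≡h)) ≼-refl)

    heavy-update : (d : Dec (k ≤ length cs)) →
      Unique (consIf d a Hs) × All (λ h → Claimed (e ∷ M) h × HeavyIn t k h) (consIf d a Hs)
    heavy-update (yes k≤) = All.map unclaimed heavy ∷ unique
                          , (here refl , subtree w , located w-fresh , k≤) ∷ All.map (map₁ there) heavy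
    heavy-update (no _)   = unique , All.map (map₁ there) heavy

    potential : Φ t + b * x ≤ Σvalue new + C * suc (length Hs')
    potential = begin
      Φ t + b * x
        ≤⟨ potential-after-claim b {Σc = cappedSum x cs} {c = C} {d = ⟦ heavy? ⟧}
             Φ≤ (K1*≤cappedSum x (subtree w) (bounded w-fresh)) ⟩
      cappedSum x cs + Σvalue R + C * suc (⟦ heavy? ⟧ + length Hs)
        ≡⟨ cong₂ (λ Σ n → Σ + C * suc n) (sym Σvalue-new) (sym (length-consIf heavy? a Hs)) ⟩
      Σvalue new + C * suc (length Hs')
        ∎
      where
      Φ≤ : Φ t ≤ x + Σvalue R + C * suc (length Hs)
      Φ≤ = subst (λ Σ → Φ t ≤ Σ + C * suc (length Hs)) (sum-map-─ value w∈T) (proj₂ inv)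
      Σvalue-new : Σvalue new ≡ cappedSum x cs + Σvalue R
      Σvalue-new = trans (sum-map-++ value (childTokens a x 0 cs) R)
                         (cong (_+ Σvalue R) (Σvalue-childTokens a x 0 cs))

    next : BreakerInvariant (e ∷ M) B new Hs'
    next = record
      { fresh     = Allₚ.++⁺ children-fresh (All.map rest-fresh (All.zip (─⁺ w∈T fresh , proj₁ R-disjoint)))
      ; disjoint  = AllPairsₚ.++⁺ (childTokens-disjoint a x 0 cs) (proj₂ R-disjoint)
                                  (All.map (λ {u} → cross {u}) (childTokens-below a x 0 cs))
      ; unique    = proj₁ (heavy-update heavy?)
      ; heavy     = proj₂ (heavy-update heavy?)
      ; connected = e-connected }
      , x , Allₚ.++⁺ (childTokens-≤ a x 0 cs) (─⁺ w∈T w-max) , potential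
      where
      cross : ∀ {u} → parent u ≡ a × 0 ≤ index u → All (Disjoint u) R
      cross {token _ j _ _} (refl , _) = All.map (Apart-∷ʳ j) (proj₁ R-disjoint)

    shrinks : Σsize new < Σsize T
    shrinks = begin-strict
      Σsize new                       ≡⟨ sum-map-++ (λ u → size (subtree u)) (childTokens a x 0 cs) R ⟩
      Σsize (childTokens a x 0 cs) + Σsize R ≡⟨ cong (_+ Σsize R) (Σsize-childTokens a x 0 cs) ⟩
      sizes cs + Σsize R              <⟨ n<1+n _ ⟩
      suc (sizes cs) + Σsize R        ≡⟨ cong (_+ Σsize R) (size-children (subtree w)) ⟨
      size (subtree w) + Σsize R      ≡⟨ sum-map-─ (λ u → size (subtree u)) w∈T ⟨
      Σsize T                         ∎

  after-reply : ∀ {M B T Hs S} → length S ≤ b → BreakerInvariant M B T Hs →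
                MakerInvariant M (S ++ B) (survivors S T) Hs
  after-reply {T = T} {S = S} |S|≤b (structure , x , T≤x , Φ+bx≤) = record
    { fresh     = All.map still-fresh (All.zip (survivors-All S fresh , survivors-outside S T))
    ; disjoint  = survivors-AllPairs S disjoint
    ; unique    = unique
    ; heavy     = heavy
    ; connected = connected }
    , potential-after-reply b Φ+bx≤ (Σvalue-survivors S disjoint T≤x) |S|≤b
    where
    open Structure structure
    still-fresh : ∀ {u} → Fresh _ _ u × (∀ {f} → f ∈ S → ¬ Within f u) → Fresh _ (S ++ _) u
    still-fresh (u-fresh , S-out) = record
      { located     = located u-fresh
      ; bounded     = bounded u-fresh
      ; maker-out   = maker-out u-fresh
      ; breaker-out = λ f∈ → Sum.[ S-out , breaker-out u-fresh ] (∈-++⁻ S f∈)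
      ; attached    = attached u-fresh }

  T₀ : List Token
  T₀ = childTokens [] (Φ t) 0 (children t)

  initial : BreakerInvariant [] [] T₀ []
  initial = record
    { fresh     = childTokens-fresh [] (Φ t) 0 (children t) (λ j eq → trans (at-child t j) eq)
                                    (λ ()) (λ ()) (inj₂ (refl , refl))
    ; disjoint  = childTokens-disjoint [] (Φ t) 0 (children t)
    ; unique    = []
    ; heavy     = []
    ; connected = λ _ _ () }
    , Φ t , childTokens-≤ [] (Φ t) 0 (children t) , (begin
      K1 * Φ t                                              ≤⟨ K1*≤cappedSum (Φ t) t ≤-refl ⟩
      cappedSum (Φ t) (children t) + C * ⟦ k ≤? length (children t) ⟧
        ≤⟨ +-monoʳ-≤ _ (*-monoʳ-≤ C (⟦⟧≤1 (k ≤? length (children t)))) ⟩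
      cappedSum (Φ t) (children t) + C * 1
        ≡⟨ cong (_+ C * 1) (Σvalue-childTokens [] (Φ t) 0 (children t)) ⟨
      Σvalue T₀ + C * 1                                     ∎)

  reached : ∀ {M B Hs} → Structure M B [] Hs → Φ t ≤ C * suc (length Hs) → Reaches M
  reached {Hs = Hs} structure Φ≤ = Hs , unique , All.map (map₁ (Any.map λ { {_ , _} refl → lower })) heavy , Φ≤
    where open Structure structure

  mutual
    play : ∀ fuel {M B T Hs} → MakerInvariant M B T Hs → Σsize T < fuel → MakerToMove M B
    play fuel       {T = []}    (structure , Φ≤) _ = done (reached structure Φ≤)
    play (suc fuel) {T = u ∷ T} inv size< =
      move e free e-connected (await fuel next (<-≤-trans shrinks (s≤s⁻¹ size<)))
      where open Claim inv (argmax-value∈ u T) (value≤argmax u T)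

    await : ∀ fuel {M B T Hs} → BreakerInvariant M B T Hs → Σsize T < fuel → BreakerToMove M B
    await fuel {T = T} inv size< = reply λ S move →
      play fuel (after-reply (BreakerMove-length move) inv) (≤-<-trans (sum-survivors≤ _ S T) size<)

  -- Moving first, Maker plays as if Breaker had opened with an empty move.
  maker-wins : MakerWinsFirst t b Reaches × MakerWinsSecond t b Reaches
  maker-wins = play (suc (Σsize T₀)) (after-reply z≤n initial) (n<1+n _)
             , await (suc (Σsize T₀)) initial (n<1+n _)

lemma13 : (k L : ℕ) → 3 ≤ k → 1 ≤ L →
    Σ ℕ λ p → Σ ℕ λ q → 0 < q × q < p ×
    Σ ℕ λ N₀ → (N : ℕ) → N₀ ≤ N → (t : RTree) → NLTree k N L t →
      MakerWinsFirst t (k ∸ 2) (Goal t k p q N)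
      × MakerWinsSecond t (k ∸ 2) (Goal t k p q N)
lemma13 (suc (suc (suc k'))) (suc L') (s≤s (s≤s (s≤s z≤n))) (s≤s z≤n) =
  p , q , s≤s z≤n , n<1+n q , N₀ , wins
  where
  open GrowthRate (2 + k') (suc L')
  wins : ∀ N → N₀ ≤ N → ∀ t → NLTree (3 + k') N (suc L') t →
         MakerWinsFirst t (suc k') (Goal t (3 + k') p q N) × MakerWinsSecond t (suc k') (Goal t (3 + k') p q N)
  wins N N₀≤N t nlt = MakerToMove-mono enough (proj₁ maker-wins) , BreakerToMove-mono enough (proj₂ maker-wins)
    where
    J = N / suc L'
    C = (2 + k') ^ J
    open Potential k' C
    open LowerBound L'
    open Strategy k' C t
    enough : ∀ {M} → Reaches M → Goal t (3 + k') p q N M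
    enough (vs , unique , heavy , Φ≤) = vs , unique , heavy ,
      ≤-*-from-ratio (length vs) {{m^n≢0 (2 + k') J}} (^-monoˡ-≤ N (n≤1+n q)) (long-run N N₀≤N) (begin
        (3 + k') ^ J                ≤⟨ k^J≤Φ+C J N t nlt (m/n*n≤m N (suc L')) ≤-refl ⟩
        Φ t + C                     ≤⟨ +-monoˡ-≤ C Φ≤ ⟩
        C * suc (length vs) + C     ≡⟨ +-comm _ C ⟩
        C + C * suc (length vs)     ≡⟨ *-suc C (suc (length vs)) ⟨
        C * (2 + length vs)         ∎)
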